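{- Let $p,q$ be positive integers with $\frac{p}{q}>2$ and $q\nmid p$. Then $\theta(K_{p/q})>1$.
   Context: For integers $p\ge 2q\ge 2$, the circular complete graph $K_{p/q}$ has vertices $v_0,\ldots,v_{p-1}$ with $v_iv_j$ an edge iff $q\le|i-j|\le p-q$. For a positive integer $k$, $G^{k}$ has vertex set $V(G)$, with $u,v$ adjacent iff there is a walk of length $k$ between them in $G$. $S_t(G)$ replaces each edge by a path with exactly $t-1$ inner vertices, and $G^{\frac{2r+1}{2s+1}}:=(S_{2s+1}(G))^{2r+1}$ for non-negative integers $r,s$. $og(G)$ is the odd girth. For a non-bipartite graph $G$, $\theta(G):=\sup\{\frac{2r+1}{2s+1}: r,s\ge 0 \text{ integers},\ \chi(G^{\frac{2r+1}{2s+1}})\le\chi(G),\ \frac{2r+1}{2s+1}<og(G)\}$. -}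

module Defs where

open import Data.Nat using (ℕ; zero; suc; _+_; _*_; _∸_; _≤_; _<_; _≤ᵇ_; ∣_-_∣)
open import Data.Bool using (Bool; T; _∧_)
open import Data.Fin as F using (Fin; toℕ)
open import Data.Product using (Σ; _×_; _,_; ∃)
open import Data.Sum using (_⊎_)
open import Relation.Binary.PropositionalEquality using (_≡_; _≢_)
open import Relation.Nullary using (¬_)
open import Function.Definitions using (Injective)

record Graph : Set₁ where
  field
    V : Set
    E : V → V → Set
open Graph public

FinGraph : ℕ → Set
FinGraph n = Fin n → Fin n → Bool

toGraph : ∀ {n} → FinGraph n → Graph
toGraph {n} adj = record { V = Fin n ; E = λ i j → T (adj i j) }

Kpq : (p q : ℕ) → FinGraph p
Kpq p q i j = (q ≤ᵇ ∣ toℕ i - toℕ j ∣) ∧ (∣ toℕ i - toℕ j ∣ ≤ᵇ p ∸ q)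

-- Each edge {i,j} (taken once, with i < j) gets inner vertices
-- inner i j _ _ 0, ..., inner i j _ _ (m-1), forming the path
-- i - inner..0 - ... - inner..(m-1) - j.
module Subdivision {n : ℕ} (adj : FinGraph n) (m : ℕ) where

  data SV : Set where
    orig  : Fin n → SV
    inner : (i j : Fin n) → i F.< j → T (adj i j) → Fin m → SV

  data Arc : SV → SV → Set where
    direct : ∀ {i j} → T (adj i j) → m ≡ 0 → Arc (orig i) (orig j)
    start  : ∀ {i j p e k} → toℕ k ≡ 0 → Arc (orig i) (inner i j p e k)
    step   : ∀ {i j p e k k′} → toℕ k′ ≡ suc (toℕ k) →
             Arc (inner i j p e k) (inner i j p e k′)
    end    : ∀ {i j p e k} → suc (toℕ k) ≡ m → Arc (inner i j p e k) (orig j)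

  graph : Graph
  graph = record { V = SV ; E = λ x y → Arc x y ⊎ Arc y x }

S : (t : ℕ) → ∀ {n} → FinGraph n → Graph
S t adj = Subdivision.graph adj (t ∸ 1)

data Walk (G : Graph) : ℕ → V G → V G → Set where
  here : ∀ {u} → Walk G zero u u
  next : ∀ {k u v w} → E G u v → Walk G k v w → Walk G (suc k) u w

power : Graph → ℕ → Graph
power G k = record { V = V G ; E = Walk G k }

-- G^{(2r+1)/(2s+1)} := (S_{2s+1}(G))^{2r+1}
fracPower : ∀ {n} → FinGraph n → (r s : ℕ) → Graph
fracPower adj r s = power (S (2 * s + 1) adj) (2 * r + 1)

Colorable : Graph → ℕ → Set
Colorable G k = Σ (V G → Fin k) λ c → ∀ u v → E G u v → c u ≢ c v

HasChromaticNumber : Graph → ℕ → Set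
HasChromaticNumber G k = Colorable G k × (∀ j → j < k → ¬ Colorable G j)

Odd : ℕ → Set
Odd l = ∃ λ k → l ≡ 2 * k + 1

HasCycle : Graph → ℕ → Set
HasCycle G l = 3 ≤ l × Σ (Fin l → V G) λ f → Injective _≡_ _≡_ f ×
  (∀ (i j : Fin l) → (toℕ j ≡ suc (toℕ i) ⊎ (suc (toℕ i) ≡ l × toℕ j ≡ 0)) →
     E G (f i) (f j))

IsOddGirth : Graph → ℕ → Set
IsOddGirth G g = Odd g × HasCycle G g × (∀ l → Odd l → HasCycle G l → g ≤ l)

-- θ(G) > 1 : the set
--   { (2r+1)/(2s+1) : χ(G^{(2r+1)/(2s+1)}) ≤ χ(G), (2r+1)/(2s+1) < og(G) }
-- has an element > 1 (equivalently its supremum exceeds 1).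
ThetaGT1 : ∀ {n} → FinGraph n → Set
ThetaGT1 adj = Σ ℕ λ r → Σ ℕ λ s →
  (2 * s + 1 < 2 * r + 1) ×
  (Σ ℕ λ k → HasChromaticNumber (toGraph adj) k × Colorable (fracPower adj r s) k) ×
  (Σ ℕ λ g → IsOddGirth (toGraph adj) g × 2 * r + 1 < g * (2 * s + 1))

-- For q ∤ p, χ(K_{p/q}) = ⌊p/q⌋ + 1: with ⌊p/q⌋ colours the colouring of v_a, read around the cycle
-- of length p, is periodic with period q·⌊p/q⌋ (pigeonhole), hence with period p % q ≠ 0, and some
-- multiple of p % q is an admissible edge length. The zigzag 0, q + 1, 1, q + 2, …, 2q, q is an odd
-- cycle, so the odd girth g exists and g ≥ 3.
--
-- The main point is that K_{p/q}^{(2s+3)/(2s+1)} is still (⌊p/q⌋ + 1)-colourable for s ≥ (⌊p/q⌋ + 1) p.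
-- Place the subdivision on a circle of length P = 2(2s+1)p, with v_i at 2(2s+1)i and each subdivided
-- edge v_i v_j (i < j) cut into 2s + 1 equal steps ending at 2(2s+1)j + sP. With e = p − 2q every step,
-- in either direction, advances by between B = 2sp + 2q and B + 2e (mod P), so a walk of length 2s + 3
-- ends at circular distance at least Q = 2((2s+1)q − e) from its start; and P ≤ (⌊p/q⌋ + 1)Q. As
-- (2s+3)/(2s+1) < 3 ≤ g, this ratio witnesses θ(K_{p/q}) > 1.

module Submission where

open import Defs
open import Data.Nat
open import Data.Nat.Properties
open import Data.Nat.DivMod
open import Data.Nat.Divisibility using (_∣_; m%n≡0⇒n∣m)
open import Data.Nat.Induction using (<-rec)
open import Data.Nat.Tactic.RingSolver using (solve-∀)
open import Data.Bool using (T)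
open import Data.Bool.Properties using (T?; T-∧)
open import Data.Fin as F using (Fin; toℕ; fromℕ<; inject≤)
open import Data.Fin.Properties
  using (any?; all?; toℕ-injective; toℕ-fromℕ<; toℕ<n; toℕ-inject≤; pigeonhole)
  renaming (_≟_ to _≟ᶠ_)
open import Data.Product
open import Data.Sum using (_⊎_; inj₁; inj₂)
open import Data.Vec.Functional using (_∷_; head; tail)
open import Function using (_∘_; _⇔_; mk⇔; Equivalence)
open import Function.Definitions using (Injective)
open import Relation.Binary.PropositionalEquality
open import Relation.Nullary
open import Relation.Nullary.Decidable using (_×-dec_; _⊎-dec_; _→-dec_; map′)
open import Relation.Unary using (Decidable)

anyFunction? : ∀ l {n} {P : (Fin l → Fin n) → Set} →
               (∀ {f g} → (∀ x → f x ≡ g x) → P f → P g) → Decidable P → Dec (∃ P)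
anyFunction? zero    resp P? = map′ (_ ,_) (λ (f , Pf) → resp (λ ()) Pf) (P? (λ ()))
anyFunction? (suc l) resp P? =
  map′ (λ (a , f , Pf) → a ∷ f , Pf)
       (λ (f , Pf) → head f , tail f , resp (λ { F.zero → refl ; (F.suc x) → refl }) Pf)
       (any? λ a → anyFunction? l (λ f≗g → resp (λ { F.zero → refl ; (F.suc x) → f≗g x }))
                                  (λ f → P? (a ∷ f)))

least : ∀ {Q : ℕ → Set} → Decidable Q → ∀ {n} → Q n → ∃ λ m → Q m × (∀ {l} → Q l → m ≤ l)
least {Q} Q? = <-rec (λ n → Q n → ∃ Least) step _
  where
  Least : ℕ → Set
  Least m = Q m × (∀ {l} → Q l → m ≤ l)
  step : ∀ n → (∀ {l} → l < n → Q l → ∃ Least) → Q n → ∃ Least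
  step n rec Qn with anyUpTo? Q? n
  ... | yes (l , l<n , Ql) = rec l<n Ql
  ... | no none            = n , Qn , λ Ql → ≮⇒≥ λ l<n → none (_ , l<n , Ql)

odd? : ∀ l → Dec (Odd l)
odd? l = map′ (λ (k , _ , e) → k , e) (λ (k , e) → k , bound k e , e)
              (anyUpTo? (λ k → l ≟ 2 * k + 1) (suc l))
  where
  bound : ∀ k → l ≡ 2 * k + 1 → k < suc l
  bound k refl = s≤s (≤-trans (m≤m+n k (k + 0)) (m≤m+n (2 * k) 1))

hasCycle? : ∀ {n} (adj : FinGraph n) l → Dec (HasCycle (toGraph adj) l)
hasCycle? {n} adj l = (3 ≤? l) ×-dec anyFunction? l respects cycle?
  where
  IsCycle : (Fin l → Fin n) → Set
  IsCycle f = Injective _≡_ _≡_ f ×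
    (∀ i j → toℕ j ≡ suc (toℕ i) ⊎ (suc (toℕ i) ≡ l × toℕ j ≡ 0) → T (adj (f i) (f j)))
  respects : ∀ {f g} → (∀ x → f x ≡ g x) → IsCycle f → IsCycle g
  respects {f} {g} f≗g (inj , adjacent) =
    (λ {x} {y} gx≡gy → inj (trans (f≗g x) (trans gx≡gy (sym (f≗g y))))) ,
    (λ i j step → subst₂ (λ a b → T (adj a b)) (f≗g i) (f≗g j) (adjacent i j step))
  cycle? : Decidable IsCycle
  cycle? f = map′ (λ h → h _ _) (λ h _ _ → h)
                  (all? λ x → all? λ y → (f x ≟ᶠ f y) →-dec (x ≟ᶠ y))
             ×-dec all? λ i → all? λ j →
               ((toℕ j ≟ suc (toℕ i)) ⊎-dec ((suc (toℕ i) ≟ l) ×-dec (toℕ j ≟ 0)))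
               →-dec T? (adj (f i) (f j))

oddGirth : ∀ {n} (adj : FinGraph n) {l} → Odd l → HasCycle (toGraph adj) l →
           ∃ (IsOddGirth (toGraph adj))
oddGirth adj ol cl with least (λ l → odd? l ×-dec hasCycle? adj l) (ol , cl)
... | g , (og , cg) , minimal = g , og , cg , λ l ol cl → minimal (ol , cl)

m/o≡n/o⇒∣m-n∣<o : ∀ m n o .{{_ : NonZero o}} → m / o ≡ n / o → ∣ m - n ∣ < o
m/o≡n/o⇒∣m-n∣<o m n o m/o≡n/o = begin-strict
  ∣ m - n ∣                                 ≡⟨ cong₂ ∣_-_∣ (split m) (trans (split n) (cong (λ x → x * o + n % o)
                                                                                         (sym m/o≡n/o))) ⟩
  ∣ m / o * o + m % o - m / o * o + n % o ∣ ≡⟨ ∣m+n-m+o∣≡∣n-o∣ (m / o * o) (m % o) (n % o) ⟩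
  ∣ m % o - n % o ∣                         ≤⟨ ∣m-n∣≤m⊔n (m % o) (n % o) ⟩
  m % o ⊔ n % o                             <⟨ ⊔-lub (m%n<n m o) (m%n<n n o) ⟩
  o                                         ∎
  where
  open ≤-Reasoning
  split : ∀ x → x ≡ x / o * o + x % o
  split x = trans (m≡m%n+[m/n]*n x o) (+-comm (x % o) (x / o * o))

%-+-congˡ : ∀ {m n} k {o} .{{_ : NonZero o}} → m % o ≡ n % o → (m + k) % o ≡ (n + k) % o
%-+-congˡ {m} {n} k {o} m≡n = begin
  (m + k) % o           ≡⟨ %-distribˡ-+ m k o ⟩
  (m % o + k % o) % o   ≡⟨ cong (λ x → (x + k % o) % o) m≡n ⟩
  (n % o + k % o) % o   ≡⟨ %-distribˡ-+ n k o ⟨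
  (n + k) % o           ∎
  where open ≡-Reasoning

∣m%o-[m+n]%o∣≡n⊎o∸n : ∀ m n o .{{_ : NonZero o}} → n ≤ o →
                ∣ m % o - (m + n) % o ∣ ≡ n ⊎ ∣ m % o - (m + n) % o ∣ ≡ o ∸ n
∣m%o-[m+n]%o∣≡n⊎o∸n m n o n≤o
  rewrite %-+-congˡ n {o = o} (sym (m%n%n≡m%n m o)) with m % o | m%n<n m o
... | a | a<o with a + n <? o
...   | yes a+n<o = inj₁ (trans (cong (∣ a -_∣) (m<n⇒m%n≡m a+n<o)) (∣m-m+n∣≡n a n))
...   | no  a+n≮o = inj₂ (begin-equality
  ∣ a - (a + n) % o ∣     ≡⟨ cong (∣ a -_∣) wrapped ⟩
  ∣ a - a + n ∸ o ∣       ≡⟨ cong (∣_- a + n ∸ o ∣) (sym a≡) ⟩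
  ∣ a + n ∸ o + (o ∸ n) - a + n ∸ o ∣ ≡⟨ ∣-∣-comm _ (a + n ∸ o) ⟩
  ∣ a + n ∸ o - a + n ∸ o + (o ∸ n) ∣ ≡⟨ ∣m-m+n∣≡n (a + n ∸ o) (o ∸ n) ⟩
  o ∸ n                   ∎)
  where
  open ≤-Reasoning
  o≤a+n : o ≤ a + n
  o≤a+n = ≮⇒≥ a+n≮o
  wrapped : (a + n) % o ≡ a + n ∸ o
  wrapped = trans (sym (m≤n⇒[n∸m]%m≡n%m o≤a+n)) (m<n⇒m%n≡m (begin-strict
    a + n ∸ o ≤⟨ ∸-monoˡ-≤ o (+-monoʳ-≤ a n≤o) ⟩
    a + o ∸ o ≡⟨ m+n∸n≡m a o ⟩
    a         <⟨ a<o ⟩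
    o         ∎))
  a≡ : a + n ∸ o + (o ∸ n) ≡ a
  a≡ = +-cancelʳ-≡ n _ a (begin-equality
    a + n ∸ o + (o ∸ n) + n   ≡⟨ +-assoc (a + n ∸ o) (o ∸ n) n ⟩
    a + n ∸ o + (o ∸ n + n)   ≡⟨ cong (a + n ∸ o +_) (m∸n+n≡m n≤o) ⟩
    a + n ∸ o + o             ≡⟨ m∸n+n≡m o≤a+n ⟩
    a + n                     ∎)

circle-gap : ∀ m n o Q .{{_ : NonZero o}} → Q ≤ n → n + Q ≤ o →
             Q ≤ ∣ m % o - (m + n) % o ∣ × ∣ m % o - (m + n) % o ∣ ≤ o ∸ Q
circle-gap m n o Q Q≤n n+Q≤o with ∣m%o-[m+n]%o∣≡n⊎o∸n m n o (m+n≤o⇒m≤o n n+Q≤o)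
... | inj₁ d≡n   rewrite d≡n   = Q≤n , m+n≤o⇒m≤o∸n n n+Q≤o
... | inj₂ d≡o∸n rewrite d≡o∸n =
  m+n≤o⇒m≤o∸n Q (subst (_≤ o) (+-comm n Q) n+Q≤o) , ∸-monoʳ-≤ o Q≤n

m<[1+m/n]*n : ∀ m n .{{_ : NonZero n}} → m < suc (m / n) * n
m<[1+m/n]*n m n = begin-strict
  m                  ≡⟨ m≡m%n+[m/n]*n m n ⟩
  m % n + m / n * n  <⟨ +-monoˡ-< (m / n * n) (m%n<n m n) ⟩
  n + m / n * n      ∎
  where open ≤-Reasoning

-- f is a homomorphism into the circular clique K_{P/Q}; each vertex is coloured by which of the
-- k arcs of length Q contains its point.
circular-colorable : ∀ (G : Graph) (f : V G → ℕ) P Q k .{{_ : NonZero P}} .{{_ : NonZero Q}} →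
  P ≤ k * Q → (∀ {u v} → E G u v → ∃ λ x → Q ≤ x × x + Q ≤ P × (f u + x) % P ≡ f v % P) →
  Colorable G k
circular-colorable G f P Q k P≤kQ displaced = colour , proper
  where
  arc<k : ∀ u → f u % P / Q < k
  arc<k u = m<n*o⇒m/o<n (<-≤-trans (m%n<n (f u) P) P≤kQ)
  colour : V G → Fin k
  colour u = fromℕ< (arc<k u)
  proper : ∀ u v → E G u v → colour u ≢ colour v
  proper u v uv same with displaced uv
  ... | x , Q≤x , x+Q≤P , fv =
    <⇒≱ (m/o≡n/o⇒∣m-n∣<o _ _ Q same-arc) (proj₁ (circle-gap (f u) x P Q Q≤x x+Q≤P))
    where
    same-arc : f u % P / Q ≡ (f u + x) % P / Q
    same-arc = begin
      f u % P / Q         ≡⟨ toℕ-fromℕ< (arc<k u) ⟨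
      toℕ (colour u)      ≡⟨ cong toℕ same ⟩
      toℕ (colour v)      ≡⟨ toℕ-fromℕ< (arc<k v) ⟩
      f v % P / Q         ≡⟨ cong (_/ Q) fv ⟨
      (f u + x) % P / Q   ∎
      where open ≡-Reasoning

colorable-mono : ∀ {G j k} → j ≤ k → Colorable G j → Colorable G k
colorable-mono j≤k (c , proper) =
  (λ u → inject≤ (c u) j≤k) ,
  (λ u v uv same → proper u v uv (toℕ-injective (begin
    toℕ (c u)                ≡⟨ toℕ-inject≤ (c u) j≤k ⟨
    toℕ (inject≤ (c u) j≤k)  ≡⟨ cong toℕ same ⟩
    toℕ (inject≤ (c v) j≤k)  ≡⟨ toℕ-inject≤ (c v) j≤k ⟩
    toℕ (c v)                ∎)))
  where open ≡-Reasoning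

Kpq-edge⇔ : ∀ p q (i j : Fin p) →
            T (Kpq p q i j) ⇔ (q ≤ ∣ toℕ i - toℕ j ∣ × ∣ toℕ i - toℕ j ∣ ≤ p ∸ q)
Kpq-edge⇔ p q i j = mk⇔ (map (≤ᵇ⇒≤ _ _) (≤ᵇ⇒≤ _ _) ∘ Equivalence.to T-∧)
                         (Equivalence.from T-∧ ∘ map ≤⇒≤ᵇ ≤⇒≤ᵇ)

Kpq-colorable : ∀ p q .{{_ : NonZero q}} → Colorable (toGraph (Kpq p q)) (suc (p / q))
Kpq-colorable p q = colour , proper
  where
  arc<k : ∀ (i : Fin p) → toℕ i / q < suc (p / q)
  arc<k i = s≤s (/-monoˡ-≤ q (<⇒≤ (toℕ<n i)))
  colour : Fin p → Fin (suc (p / q))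
  colour i = fromℕ< (arc<k i)
  proper : ∀ i j → T (Kpq p q i j) → colour i ≢ colour j
  proper i j ij same = <⇒≱ (m/o≡n/o⇒∣m-n∣<o (toℕ i) (toℕ j) q
    (trans (sym (toℕ-fromℕ< (arc<k i))) (trans (cong toℕ same) (toℕ-fromℕ< (arc<k j)))))
    (proj₁ (Equivalence.to (Kpq-edge⇔ p q i j) ij))

Kpq-shift-edge : ∀ p q a d .{{_ : NonZero p}} → q ≤ d → d + q ≤ p →
                 T (Kpq p q (a mod p) ((a + d) mod p))
Kpq-shift-edge p q a d q≤d d+q≤p = Equivalence.from (Kpq-edge⇔ p q (a mod p) ((a + d) mod p))
  (subst₂ (λ x y → q ≤ ∣ x - y ∣ × ∣ x - y ∣ ≤ p ∸ q)
     (sym (toℕ-fromℕ< (m%n<n a p))) (sym (toℕ-fromℕ< (m%n<n (a + d) p)))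
     (circle-gap a d p q q≤d d+q≤p))

Advance : ∀ P .{{_ : NonZero P}} → ℕ → ℕ → ℕ → ℕ → Set
Advance P B D a b = ∃ λ w → w ≤ D × (a + (B + w)) % P ≡ b % P

module _ {P : ℕ} .{{_ : NonZero P}} where

  advance-trans : ∀ {B B′ D D′ a b c} → Advance P B D a b → Advance P B′ D′ b c →
                  Advance P (B + B′) (D + D′) a c
  advance-trans {B} {B′} {D} {D′} {a} {b} {c} (w , w≤D , ab) (w′ , w′≤D′ , bc) =
    w + w′ , +-mono-≤ w≤D w′≤D′ , (begin
      (a + (B + B′ + (w + w′))) % P     ≡⟨ cong (_% P) (regroup a B B′ w w′) ⟩
      (a + (B + w) + (B′ + w′)) % P     ≡⟨ %-+-congˡ (B′ + w′) ab ⟩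
      (b + (B′ + w′)) % P               ≡⟨ bc ⟩
      c % P                             ∎)
    where
    open ≡-Reasoning
    regroup : ∀ a B B′ w w′ → a + (B + B′ + (w + w′)) ≡ a + (B + w) + (B′ + w′)
    regroup = solve-∀

  -- The way back is the complementary arc, of length P ∸ (B + w) = B + (D ∸ w).
  advance-sym : ∀ {B D a b} → P ≡ B + B + D → Advance P B D a b → Advance P B D b a
  advance-sym {B} {D} {a} {b} P≡ (w , w≤D , ab) = D ∸ w , m∸n≤m D w , (begin
    (b + (B + (D ∸ w))) % P           ≡⟨ %-+-congˡ (B + (D ∸ w)) ab ⟨
    (a + (B + w) + (B + (D ∸ w))) % P ≡⟨ cong (_% P) full-turn ⟩
    (a + P) % P                       ≡⟨ [m+n]%n≡m%n a P ⟩
    a % P                             ∎)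
    where
    open ≡-Reasoning
    regroup : ∀ a B w x → a + (B + w) + (B + x) ≡ a + (B + B + (x + w))
    regroup = solve-∀
    full-turn : a + (B + w) + (B + (D ∸ w)) ≡ a + P
    full-turn = trans (regroup a B w (D ∸ w)) (cong (a +_) (trans (cong (B + B +_) (m∸n+n≡m w≤D)) (sym P≡)))

walk-advance : ∀ {G : Graph} (f : V G → ℕ) {P} .{{_ : NonZero P}} {B D} →
               (∀ {u v} → E G u v → Advance P B D (f u) (f v)) →
               ∀ {L u v} → Walk G L u v → Advance P (L * B) (L * D) (f u) (f v)
walk-advance f {P} edge (here {u}) = 0 , z≤n , cong (_% P) (+-identityʳ (f u))
walk-advance f {B = B} edge (next {u = u} uv walk) =
  advance-trans {B = B} {a = f u} (edge uv) (walk-advance f edge walk)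

module KpqColouring (p q : ℕ) .{{_ : NonZero p}} .{{_ : NonZero q}}
                    (c : Fin p → Fin (p / q)) (proper : ∀ i j → T (Kpq p q i j) → c i ≢ c j) where

  m δ : ℕ
  m = p / q
  δ = p % q

  p≡δ+mq : p ≡ δ + m * q
  p≡δ+mq = m≡m%n+[m/n]*n p q

  colour : ℕ → Fin m
  colour a = c (a mod p)

  separated : ∀ a d → q ≤ d → d + q ≤ p → colour a ≢ colour (a + d)
  separated a d q≤d d+q≤p = proper _ _ (Kpq-shift-edge p q a d q≤d d+q≤p)

  separated-multiple : ∀ a k → 0 < k → k < m → colour a ≢ colour (a + k * q)
  separated-multiple a k 0<k k<m = separated a (k * q) (m≤n*m q k {{>-nonZero 0<k}}) (begin
    k * q + q  ≡⟨ +-comm (k * q) q ⟩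
    suc k * q  ≤⟨ *-monoˡ-≤ q k<m ⟩
    m * q      ≤⟨ m≤n+m (m * q) δ ⟩
    δ + m * q  ≡⟨ p≡δ+mq ⟨
    p          ∎)
    where open ≤-Reasoning

  -- Of the points a, a + q, …, a + m q only the extreme pair is not separated.
  repeat⇒periodic : ∀ a i j → i < j → j ≤ m →
                    colour (a + i * q) ≡ colour (a + j * q) → colour (a + m * q) ≡ colour a
  repeat⇒periodic a zero j 0<j j≤m same with m≤n⇒m<n∨m≡n j≤m
  ... | inj₁ j<m  = contradiction (trans (cong colour (sym (+-identityʳ a))) same)
                                  (separated-multiple a j 0<j j<m)
  ... | inj₂ refl = trans (sym same) (cong colour (+-identityʳ a))
  repeat⇒periodic a (suc i) j i<j j≤m same =
    contradiction (trans same (cong colour a+jq≡)) (separated-multiple (a + suc i * q) (j ∸ suc i)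
      (m<n⇒0<n∸m i<j) (<-≤-trans (∸-monoʳ-< z<s (<⇒≤ i<j)) j≤m))
    where
    a+jq≡ : a + j * q ≡ a + suc i * q + (j ∸ suc i) * q
    a+jq≡ = begin
      a + j * q                          ≡⟨ cong (λ x → a + x * q) (m+[n∸m]≡n (<⇒≤ i<j)) ⟨
      a + (suc i + (j ∸ suc i)) * q      ≡⟨ cong (a +_) (*-distribʳ-+ q (suc i) (j ∸ suc i)) ⟩
      a + (suc i * q + (j ∸ suc i) * q)  ≡⟨ +-assoc a (suc i * q) _ ⟨
      a + suc i * q + (j ∸ suc i) * q    ∎
      where open ≡-Reasoning

  periodic-mq : ∀ a → colour (a + m * q) ≡ colour a
  periodic-mq a with pigeonhole (n<1+n m) (λ i → colour (a + toℕ i * q))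
  ... | i , j , i<j , same = repeat⇒periodic a (toℕ i) (toℕ j) i<j (≤-pred (toℕ<n j)) same

  periodic-δ : ∀ a → colour (a + δ) ≡ colour a
  periodic-δ a = begin
    colour (a + δ)          ≡⟨ periodic-mq (a + δ) ⟨
    colour (a + δ + m * q)  ≡⟨ cong colour (trans (+-assoc a δ (m * q)) (cong (a +_) (sym p≡δ+mq))) ⟩
    colour (a + p)          ≡⟨ cong c (toℕ-injective (begin
      toℕ ((a + p) mod p)      ≡⟨ toℕ-fromℕ< _ ⟩
      (a + p) % p              ≡⟨ [m+n]%n≡m%n a p ⟩
      a % p                    ≡⟨ toℕ-fromℕ< _ ⟨
      toℕ (a mod p)            ∎)) ⟩
    colour a                ∎
    where open ≡-Reasoning

  periodic-*δ : ∀ t → colour (t * δ) ≡ colour 0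
  periodic-*δ zero    = refl
  periodic-*δ (suc t) = trans (cong colour (+-comm δ (t * δ))) (trans (periodic-δ (t * δ)) (periodic-*δ t))

Kpq-not-colorable : ∀ p q .{{_ : NonZero p}} .{{_ : NonZero q}} → 2 * q < p → ¬ q ∣ p →
                    ¬ Colorable (toGraph (Kpq p q)) (p / q)
Kpq-not-colorable p q 2q<p q∤p (c , proper) =
  separated 0 (t * δ) (<⇒≤ (m<[1+m/n]*n q δ)) tδ+q≤p (sym (periodic-*δ t))
  where
  open KpqColouring p q c proper
  instance
    δ≢0 : NonZero δ
    δ≢0 = ≢-nonZero λ δ≡0 → q∤p (m%n≡0⇒n∣m p q δ≡0)
  t : ℕ
  t = suc (q / δ)
  tδ+q≤p : t * δ + q ≤ p
  tδ+q≤p = begin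
    δ + q / δ * δ + q    ≡⟨ +-assoc δ (q / δ * δ) q ⟩
    δ + (q / δ * δ + q)  ≤⟨ +-monoʳ-≤ δ (+-monoˡ-≤ q (m/n*n≤m q δ)) ⟩
    δ + (q + q)          ≡⟨ cong (λ x → δ + (q + x)) (+-identityʳ q) ⟨
    δ + 2 * q            ≤⟨ +-monoʳ-≤ δ (*-monoˡ-≤ q 2≤m) ⟩
    δ + m * q            ≡⟨ p≡δ+mq ⟨
    p                    ∎
    where
    open ≤-Reasoning
    2≤m : 2 ≤ m
    2≤m = subst (_≤ m) (m*n/n≡m 2 q) (/-monoˡ-≤ q (<⇒≤ 2q<p))

module _ (q : ℕ) where

  -- 0, q + 1, 1, q + 2, 2, …, 2q, q: steps alternate between q + 1 forward and q backward.
  zigzag : ℕ → ℕ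
  zigzag zero          = zero
  zigzag (suc zero)    = suc q
  zigzag (suc (suc t)) = suc (zigzag t)

  zigzag-even : ∀ c → zigzag (2 * c) ≡ c
  zigzag-even zero    = refl
  zigzag-even (suc c) rewrite *-suc 2 c = cong suc (zigzag-even c)

  zigzag-step : ∀ t → ∣ zigzag t - zigzag (suc t) ∣ ≡ suc q ⊎ ∣ zigzag t - zigzag (suc t) ∣ ≡ q
  zigzag-step zero          = inj₁ refl
  zigzag-step (suc zero)    = inj₂ (∣-∣-identityʳ q)
  zigzag-step (suc (suc t)) = zigzag-step t

  2*zigzag≤ : ∀ t → 2 * zigzag t ≤ 2 * q + 1 + t
  2*zigzag≤ zero          = z≤n
  2*zigzag≤ (suc zero)    = ≤-reflexive (double-suc q)
    where
    double-suc : ∀ q → 2 * suc q ≡ 2 * q + 1 + 1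
    double-suc = solve-∀
  2*zigzag≤ (suc (suc t)) = begin
    2 * suc (zigzag t)      ≡⟨ *-suc 2 (zigzag t) ⟩
    2 + 2 * zigzag t        ≤⟨ +-monoʳ-≤ 2 (2*zigzag≤ t) ⟩
    2 + (2 * q + 1 + t)     ≡⟨ shift (2 * q + 1) t ⟩
    2 * q + 1 + suc (suc t) ∎
    where
    open ≤-Reasoning
    shift : ∀ a t → 2 + (a + t) ≡ a + suc (suc t)
    shift = solve-∀

  zigzag<2q+1 : ∀ t → t ≤ 2 * q → zigzag t < 2 * q + 1
  zigzag<2q+1 t t≤2q = *-cancelˡ-< 2 _ _ (begin-strict
    2 * zigzag t             ≤⟨ 2*zigzag≤ t ⟩
    2 * q + 1 + t            <⟨ +-monoʳ-< (2 * q + 1) (≤-trans (s≤s t≤2q) (≤-reflexive (+-comm 1 (2 * q)))) ⟩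
    2 * q + 1 + (2 * q + 1)  ≡⟨ cong (2 * q + 1 +_) (+-identityʳ (2 * q + 1)) ⟨
    2 * (2 * q + 1)          ∎)
    where open ≤-Reasoning

  zigzag≤q⇒even : ∀ t → zigzag t ≤ q → t ≡ 2 * zigzag t
  zigzag≤q⇒even zero          _     = refl
  zigzag≤q⇒even (suc zero)    q+1≤q = contradiction q+1≤q (n≮n q)
  zigzag≤q⇒even (suc (suc t)) z<q   =
    trans (cong (suc ∘ suc) (zigzag≤q⇒even t (<⇒≤ z<q))) (sym (*-suc 2 (zigzag t)))

  -- zigzag 1 = q + 1 is hit only at t = 1, because zigzag t = q forces t = 2q.
  peak-unique : ∀ {t} → suc (suc t) ≤ 2 * q → q ≢ zigzag t
  peak-unique {t} t+2≤2q q≡z =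
    1+n≰n (≤-trans (n≤1+n _) (subst (λ x → suc (suc x) ≤ 2 * q) t≡2q t+2≤2q))
    where
    t≡2q : t ≡ 2 * q
    t≡2q = trans (zigzag≤q⇒even t (≤-reflexive (sym q≡z))) (cong (2 *_) (sym q≡z))

  zigzag-injective : ∀ {t t′} → t ≤ 2 * q → t′ ≤ 2 * q → zigzag t ≡ zigzag t′ → t ≡ t′
  zigzag-injective {zero}        {zero}         _ _ _ = refl
  zigzag-injective {zero}        {suc zero}     _ _ ()
  zigzag-injective {zero}        {suc (suc _)}  _ _ ()
  zigzag-injective {suc zero}    {zero}         _ _ ()
  zigzag-injective {suc (suc _)} {zero}         _ _ ()
  zigzag-injective {suc zero}    {suc zero}     _ _ _ = refl
  zigzag-injective {suc zero}    {suc (suc t′)} _ t′+2≤2q eq =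
    contradiction (suc-injective eq) (peak-unique t′+2≤2q)
  zigzag-injective {suc (suc t)} {suc zero}     t+2≤2q _ eq =
    contradiction (sym (suc-injective eq)) (peak-unique t+2≤2q)
  zigzag-injective {suc (suc t)} {suc (suc t′)} t+2≤2q t′+2≤2q eq =
    cong (suc ∘ suc) (zigzag-injective (≤-trans (n≤1+n t) (m+n≤o⇒n≤o 1 t+2≤2q))
                                       (≤-trans (n≤1+n t′) (m+n≤o⇒n≤o 1 t′+2≤2q)) (suc-injective eq))

  zigzag-cyclic-step : ∀ t t′ → t′ ≡ suc t ⊎ (suc t ≡ 2 * q + 1 × t′ ≡ 0) →
                       ∣ zigzag t - zigzag t′ ∣ ≡ suc q ⊎ ∣ zigzag t - zigzag t′ ∣ ≡ q
  zigzag-cyclic-step t _ (inj₁ refl) = zigzag-step t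
  zigzag-cyclic-step t _ (inj₂ (t+1≡2q+1 , refl))
    rewrite suc-injective (trans t+1≡2q+1 (+-comm (2 * q) 1)) | zigzag-even q = inj₂ (∣-∣-identityʳ q)

Kpq-oddCycle : ∀ p q → 0 < q → 2 * q < p → HasCycle (toGraph (Kpq p q)) (2 * q + 1)
Kpq-oddCycle p q 0<q 2q<p = +-monoˡ-≤ 1 (*-monoʳ-≤ 2 0<q) , vertex , injective , adjacent
  where
  t≤2q : ∀ (t : Fin (2 * q + 1)) → toℕ t ≤ 2 * q
  t≤2q t = ≤-pred (≤-trans (toℕ<n t) (≤-reflexive (+-comm (2 * q) 1)))
  2q+1≤p : 2 * q + 1 ≤ p
  2q+1≤p = ≤-trans (≤-reflexive (+-comm (2 * q) 1)) 2q<p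
  vertex : Fin (2 * q + 1) → Fin p
  vertex t = fromℕ< (<-≤-trans (zigzag<2q+1 q (toℕ t) (t≤2q t)) 2q+1≤p)
  toℕ-vertex : ∀ t → toℕ (vertex t) ≡ zigzag q (toℕ t)
  toℕ-vertex t = toℕ-fromℕ< _
  injective : ∀ {t t′} → vertex t ≡ vertex t′ → t ≡ t′
  injective {t} {t′} eq = toℕ-injective (zigzag-injective q (t≤2q t) (t≤2q t′)
    (trans (sym (toℕ-vertex t)) (trans (cong toℕ eq) (toℕ-vertex t′))))
  q+1≤p∸q : suc q ≤ p ∸ q
  q+1≤p∸q = m+n≤o⇒m≤o∸n (suc q) (≤-trans (≤-reflexive (q+1+q q)) 2q+1≤p)
    where
    q+1+q : ∀ q → suc q + q ≡ 2 * q + 1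
    q+1+q = solve-∀
  edge-length : ∀ {d} → d ≡ suc q ⊎ d ≡ q → q ≤ d × d ≤ p ∸ q
  edge-length (inj₁ refl) = n≤1+n q , q+1≤p∸q
  edge-length (inj₂ refl) = ≤-refl , ≤-trans (n≤1+n q) q+1≤p∸q
  adjacent : ∀ (i j : Fin (2 * q + 1)) → toℕ j ≡ suc (toℕ i) ⊎ (suc (toℕ i) ≡ 2 * q + 1 × toℕ j ≡ 0) →
             T (Kpq p q (vertex i) (vertex j))
  adjacent i j step = Equivalence.from (Kpq-edge⇔ p q (vertex i) (vertex j))
    (subst₂ (λ x y → q ≤ ∣ x - y ∣ × ∣ x - y ∣ ≤ p ∸ q) (sym (toℕ-vertex i)) (sym (toℕ-vertex j))
      (edge-length (zigzag-cyclic-step q (toℕ i) (toℕ j) step)))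

module FracPowerColouring (q e s : ℕ) .{{_ : NonZero q}}
                          (kp≤s : suc ((2 * q + e) / q) * (2 * q + e) ≤ s) where

  p k M L B P R Q : ℕ
  p = 2 * q + e
  k = suc (p / q)
  M = 2 * s + 1
  L = 2 * suc s + 1
  B = 2 * s * p + 2 * q
  P = 2 * M * p
  R = M * q ∸ e
  Q = 2 * R

  0<p : 0 < p
  0<p = ≤-trans (>-nonZero⁻¹ q) (≤-trans (m≤m+n q (q + 0)) (m≤m+n (2 * q) e))

  p≤s : p ≤ s
  p≤s = ≤-trans (m≤n*m p k) kp≤s

  s≤M : s ≤ M
  s≤M = ≤-trans (m≤m+n s (s + 0)) (m≤m+n (2 * s) 1)

  e≤p : e ≤ p
  e≤p = m≤n+m e (2 * q)

  instance
    M≢0 : NonZero M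
    M≢0 = >-nonZero (m≤n+m 1 (2 * s))
    p≢0 : NonZero p
    p≢0 = >-nonZero 0<p
    P≢0 : NonZero P
    P≢0 = m*n≢0 (2 * M) p {{m*n≢0 2 M}}

  R+e≡Mq : R + e ≡ M * q
  R+e≡Mq = m∸n+n≡m (≤-trans e≤p (≤-trans p≤s (≤-trans s≤M (m≤m*n M q))))

  Q+2e≡2Mq : Q + 2 * e ≡ 2 * (M * q)
  Q+2e≡2Mq = trans (sym (*-distribˡ-+ 2 R e)) (cong (2 *_) R+e≡Mq)

  P≡B+B+2e : P ≡ B + B + 2 * e
  P≡B+B+2e = identity q e s
    where
    identity : ∀ q e s → 2 * (2 * s + 1) * (2 * q + e) ≡
               2 * s * (2 * q + e) + 2 * q + (2 * s * (2 * q + e) + 2 * q) + 2 * e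
    identity = solve-∀

  LB≡Q+[1+s]P : L * B ≡ Q + suc s * P
  LB≡Q+[1+s]P = +-cancelʳ-≡ (2 * e) _ _ (begin
    L * B + 2 * e            ≡⟨ identity q e s ⟩
    2 * (M * q) + suc s * P  ≡⟨ cong (_+ suc s * P) Q+2e≡2Mq ⟨
    Q + 2 * e + suc s * P    ≡⟨ +-comm-middle Q (2 * e) (suc s * P) ⟩
    Q + suc s * P + 2 * e    ∎)
    where
    open ≡-Reasoning
    identity : ∀ q e s → (2 * suc s + 1) * (2 * s * (2 * q + e) + 2 * q) + 2 * e ≡
               2 * ((2 * s + 1) * q) + suc s * (2 * (2 * s + 1) * (2 * q + e))
    identity = solve-∀
    +-comm-middle : ∀ a b c → a + b + c ≡ a + c + b
    +-comm-middle = solve-∀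

  Q+L2e+Q≡P : Q + L * (2 * e) + Q ≡ P
  Q+L2e+Q≡P = +-cancelʳ-≡ (2 * e + 2 * e) _ _ (begin
    Q + L * (2 * e) + Q + (2 * e + 2 * e)            ≡⟨ regroup Q (L * (2 * e)) (2 * e) ⟩
    Q + 2 * e + L * (2 * e) + (Q + 2 * e)            ≡⟨ cong₂ (λ x y → x + L * (2 * e) + y) Q+2e≡2Mq Q+2e≡2Mq ⟩
    2 * (M * q) + L * (2 * e) + 2 * (M * q)          ≡⟨ identity q e s ⟩
    P + (2 * e + 2 * e)                              ∎)
    where
    open ≡-Reasoning
    regroup : ∀ a b c → a + b + a + (c + c) ≡ a + c + b + (a + c)
    regroup = solve-∀
    identity : ∀ q e s → 2 * ((2 * s + 1) * q) + (2 * suc s + 1) * (2 * e) + 2 * ((2 * s + 1) * q) ≡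
               2 * (2 * s + 1) * (2 * q + e) + (2 * e + 2 * e)
    identity = solve-∀

  P≤kQ : P ≤ k * Q
  P≤kQ = begin
    P            ≡⟨ *-assoc 2 M p ⟩
    2 * (M * p)  ≤⟨ *-monoʳ-≤ 2 Mp≤kR ⟩
    2 * (k * R)  ≡⟨ *-comm-left 2 k R ⟩
    k * Q        ∎
    where
    open ≤-Reasoning
    *-comm-left : ∀ a b c → a * (b * c) ≡ b * (a * c)
    *-comm-left = solve-∀
    ke≤M : k * e ≤ M
    ke≤M = ≤-trans (*-monoʳ-≤ k e≤p) (≤-trans kp≤s s≤M)
    Mp≤kR : M * p ≤ k * R
    Mp≤kR = +-cancelʳ-≤ (k * e) _ _ (begin
      M * p + k * e    ≤⟨ +-monoʳ-≤ (M * p) ke≤M ⟩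
      M * p + M        ≡⟨ trans (+-comm (M * p) M) (sym (*-suc M p)) ⟩
      M * suc p        ≤⟨ *-monoʳ-≤ M (m<[1+m/n]*n p q) ⟩
      M * (k * q)      ≡⟨ *-comm-left M k q ⟩
      k * (M * q)      ≡⟨ cong (k *_) R+e≡Mq ⟨
      k * (R + e)      ≡⟨ *-distribˡ-+ k R e ⟩
      k * R + k * e    ∎)

  gap : Fin p → Fin p → ℕ
  gap i j = toℕ j ∸ toℕ i ∸ q

  forward-edge : ∀ {i j} → i F.< j → T (Kpq p q i j) → toℕ j ≡ toℕ i + (q + gap i j) × gap i j ≤ e
  forward-edge {i} {j} i<j ij with Equivalence.to (Kpq-edge⇔ p q i j) ij
  ... | q≤d , d≤p∸q rewrite m≤n⇒∣m-n∣≡n∸m (<⇒≤ i<j) =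
    trans (sym (m+[n∸m]≡n (<⇒≤ i<j))) (cong (toℕ i +_) (sym (m+[n∸m]≡n q≤d))) ,
    (begin
      toℕ j ∸ toℕ i ∸ q  ≤⟨ ∸-monoˡ-≤ q d≤p∸q ⟩
      p ∸ q ∸ q          ≡⟨ ∸-+-assoc p q q ⟩
      p ∸ (q + q)        ≡⟨ cong (λ x → p ∸ (q + x)) (+-identityʳ q) ⟨
      p ∸ 2 * q          ≡⟨ m+n∸m≡n (2 * q) e ⟩
      e                  ∎)
    where open ≤-Reasoning

  open Subdivision (Kpq p q) (2 * s + 1 ∸ 1)

  -- The subdivided edge i < j becomes 2s + 1 equal steps of length B + 2 gap starting at 2 M i;
  -- they end at 2 M j + s P.
  lift : SV → ℕ
  lift (orig i)          = 2 * M * toℕ i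
  lift (inner i j _ _ t) = 2 * M * toℕ i + suc (toℕ t) * (B + 2 * gap i j)

  arc-advance : ∀ {u v} → Arc u v → Advance P B (2 * e) (lift u) (lift v)
  arc-advance (direct _ 2s≡0) =
    contradiction (m+n≡0⇒m≡0 s (trans (sym (m+n∸n≡m (2 * s) 1)) 2s≡0))
                  (≢-nonZero⁻¹ s {{>-nonZero 0<s}})
    where
    0<s : 0 < s
    0<s = ≤-trans 0<p p≤s
  arc-advance (start {i} {j} {i<j} {ij} {t} t≡0) =
    2 * gap i j , *-monoʳ-≤ 2 (proj₂ (forward-edge i<j ij)) ,
    cong (λ x → (2 * M * toℕ i + x) % P) (trans (sym (*-identityˡ _)) (cong (λ n → suc n * _) (sym t≡0)))
  arc-advance (step {i} {j} {i<j} {ij} {t} {t′} t′≡t+1) =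
    2 * gap i j , *-monoʳ-≤ 2 (proj₂ (forward-edge i<j ij)) ,
    cong (_% P) (trans (one-more-step (2 * M * toℕ i) (toℕ t) (B + 2 * gap i j))
                       (cong (λ n → 2 * M * toℕ i + suc n * (B + 2 * gap i j)) (sym t′≡t+1)))
    where
    one-more-step : ∀ a t A → a + suc t * A + A ≡ a + suc (suc t) * A
    one-more-step = solve-∀
  arc-advance (end {i} {j} {i<j} {ij} {t} t+1≡2s) =
    2 * gap i j , *-monoʳ-≤ 2 gap≤e , (begin
      (2 * M * toℕ i + suc (toℕ t) * A + A) % P       ≡⟨ cong (λ n → (2 * M * toℕ i + n * A + A) % P)
                                                              (trans t+1≡2s (m+n∸n≡m (2 * s) 1)) ⟩
      (2 * M * toℕ i + 2 * s * A + A) % P             ≡⟨ cong (_% P) (last-step (toℕ i) q e s (gap i j)) ⟩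
      (2 * M * (toℕ i + (q + gap i j)) + s * P) % P   ≡⟨ [m+kn]%n≡m%n _ s P ⟩
      2 * M * (toℕ i + (q + gap i j)) % P             ≡⟨ cong (λ x → 2 * M * x % P) j≡ ⟨
      2 * M * toℕ j % P                               ∎)
    where
    open ≡-Reasoning
    A : ℕ
    A = B + 2 * gap i j
    j≡ : toℕ j ≡ toℕ i + (q + gap i j)
    j≡ = proj₁ (forward-edge i<j ij)
    gap≤e : gap i j ≤ e
    gap≤e = proj₂ (forward-edge i<j ij)
    last-step : ∀ i q e s g →
      2 * (2 * s + 1) * i + 2 * s * (2 * s * (2 * q + e) + 2 * q + 2 * g) + (2 * s * (2 * q + e) + 2 * q + 2 * g) ≡
      2 * (2 * s + 1) * (i + (q + g)) + s * (2 * (2 * s + 1) * (2 * q + e))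
    last-step = solve-∀

  edge-advance : ∀ {u v} → Arc u v ⊎ Arc v u → Advance P B (2 * e) (lift u) (lift v)
  edge-advance (inj₁ uv) = arc-advance uv
  edge-advance {u} {v} (inj₂ vu) = advance-sym {B = B} {a = lift v} P≡B+B+2e (arc-advance vu)

  -- A walk of length L advances by L B + W ≡ Q + W (mod P) with W ≤ L · 2e,
  -- i.e. by an amount in [Q, P ∸ Q].
  colorable : Colorable (fracPower (Kpq p q) (suc s) s) k
  colorable = circular-colorable _ lift P Q k {{_}} {{Q≢0}} P≤kQ walk-displacement
    where
    Q≢0 : NonZero Q
    Q≢0 = ≢-nonZero λ Q≡0 →
      ≢-nonZero⁻¹ P (n≤0⇒n≡0 (≤-trans P≤kQ (≤-reflexive (trans (cong (k *_) Q≡0) (*-zeroʳ k)))))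
    walk-displacement : ∀ {u v} → Walk graph L u v →
                        ∃ λ x → Q ≤ x × x + Q ≤ P × (lift u + x) % P ≡ lift v % P
    walk-displacement {u} {v} walk = reduce (walk-advance lift {P = P} {B = B} edge-advance walk)
      where
      reduce : Advance P (L * B) (L * (2 * e)) (lift u) (lift v) →
               ∃ λ x → Q ≤ x × x + Q ≤ P × (lift u + x) % P ≡ lift v % P
      reduce (W , W≤ , advance) = Q + W , m≤m+n Q W ,
        ≤-trans (+-monoˡ-≤ Q (+-monoʳ-≤ Q W≤)) (≤-reflexive Q+L2e+Q≡P) , (begin
          (lift u + (Q + W)) % P                ≡⟨ [m+kn]%n≡m%n (lift u + (Q + W)) (suc s) P ⟨
          (lift u + (Q + W) + suc s * P) % P    ≡⟨ cong (_% P) (regroup (lift u) Q W (suc s * P)) ⟩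
          (lift u + (Q + suc s * P + W)) % P    ≡⟨ cong (λ x → (lift u + (x + W)) % P) LB≡Q+[1+s]P ⟨
          (lift u + (L * B + W)) % P            ≡⟨ advance ⟩
          lift v % P                            ∎)
        where
        open ≡-Reasoning
        regroup : ∀ a Q W x → a + (Q + W) + x ≡ a + (Q + x + W)
        regroup = solve-∀

Kpq-fracPower-colorable : ∀ p q s .{{_ : NonZero q}} → 2 * q ≤ p → suc (p / q) * p ≤ s →
                          Colorable (fracPower (Kpq p q) (suc s) s) (suc (p / q))
Kpq-fracPower-colorable p q s 2q≤p kp≤s with m≤n⇒∃[o]m+o≡n 2q≤p
... | e , refl = FracPowerColouring.colorable q e s kp≤s

Kpq-chromatic : ∀ p q .{{_ : NonZero p}} .{{_ : NonZero q}} → 2 * q < p → ¬ q ∣ p →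
                HasChromaticNumber (toGraph (Kpq p q)) (suc (p / q))
Kpq-chromatic p q 2q<p q∤p =
  Kpq-colorable p q , λ j j≤m → Kpq-not-colorable p q 2q<p q∤p ∘ colorable-mono (≤-pred j≤m)

[2s+3]<3[2s+1] : ∀ s → 0 < s → 2 * suc s + 1 < 3 * (2 * s + 1)
[2s+3]<3[2s+1] (suc t) _ = begin
  suc (2 * suc (suc t) + 1)  ≡⟨ left t ⟩
  2 * t + 6                  ≤⟨ m≤m+n (2 * t + 6) (4 * t + 3) ⟩
  2 * t + 6 + (4 * t + 3)    ≡⟨ right t ⟨
  3 * (2 * suc t + 1)        ∎
  where
  open ≤-Reasoning
  left : ∀ t → suc (2 * suc (suc t) + 1) ≡ 2 * t + 6
  left = solve-∀
  right : ∀ t → 3 * (2 * suc t + 1) ≡ 2 * t + 6 + (4 * t + 3)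
  right = solve-∀

theorem4p2 : (p q : ℕ) → 0 < q → 2 * q < p → ¬ (q ∣ p) → ThetaGT1 (Kpq p q)
theorem4p2 p q 0<q 2q<p q∤p with oddGirth (Kpq p q) (q , refl) (Kpq-oddCycle p q 0<q 2q<p)
... | g , girth@(_ , (3≤g , _) , _) =
  suc s , s , +-monoˡ-< 1 (*-monoʳ-< 2 (n<1+n s)) ,
  (suc (p / q) , Kpq-chromatic p q 2q<p q∤p , Kpq-fracPower-colorable p q s (<⇒≤ 2q<p) ≤-refl) ,
  (g , girth , <-≤-trans ([2s+3]<3[2s+1] s 0<s) (*-monoˡ-≤ (2 * s + 1) 3≤g))
  where
  0<p : 0 < p
  0<p = <-≤-trans 0<q (≤-trans (m≤m+n q (q + 0)) (<⇒≤ 2q<p))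
  instance
    q≢0 : NonZero q
    q≢0 = >-nonZero 0<q
    p≢0 : NonZero p
    p≢0 = >-nonZero 0<p
  s : ℕ
  s = suc (p / q) * p
  0<s : 0 < s
  0<s = ≤-trans 0<p (m≤n*m p (suc (p / q)))
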